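{- Let $n,k\ge 1$. If $nK_2$ is $k$-super graceful, then $3n(2k+3n-1)/2$ is even and $n\ge 2k-1$.
   Context: $nK_2$ denotes the disjoint union of $n$ copies of $K_2$. For integers $a\le b$, $[a,b]$ is the set of integers between $a$ and $b$ inclusive. For $k\ge 1$, a $k$-super graceful labeling of a graph $G=(V,E)$ with $p$ vertices and $q$ edges is a bijection $f:V\cup E\to[k,k+p+q-1]$ with $f(uv)=|f(u)-f(v)|$ for every edge $uv$; $G$ is $k$-super graceful if it admits one. -}

module Defs where

open import Data.Nat using (ℕ; _+_; ∣_-_∣)
open import Data.Fin using (Fin; toℕ; _↑ˡ_; _↑ʳ_)
open import Data.Sum using (_⊎_; inj₁; inj₂)
open import Data.Product using (Σ; _×_; _,_; proj₁; proj₂)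
open import Function.Bundles using (_⤖_; Bijection)
open import Relation.Binary.PropositionalEquality using (_≡_)

record Graph : Set where
  field
    p    : ℕ
    q    : ℕ
    ends : Fin q → Fin p × Fin p
open Graph public

nK₂ : ℕ → Graph
nK₂ n = record { p = n + n ; q = n ; ends = λ i → (i ↑ˡ n , n ↑ʳ i) }

Elem : Graph → Set
Elem G = Fin (p G) ⊎ Fin (q G)

-- A k-super graceful labeling: a bijection f : V ∪ E → [k, k+p+q-1],
-- encoded as a bijection b : V ⊎ E → Fin (p+q) with f x = k + toℕ (b x),
-- such that f(uv) = |f(u) - f(v)| for every edge uv.
record SuperGracefulLabeling (k : ℕ) (G : Graph) : Set where
  field
    bij : Elem G ⤖ Fin (p G + q G)
  label : Elem G → ℕ
  label x = k + toℕ (Bijection.to bij x)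
  field
    edge-cond : (e : Fin (q G)) →
      label (inj₂ e) ≡ ∣ label (inj₁ (proj₁ (ends G e))) - label (inj₁ (proj₂ (ends G e))) ∣

IsSuperGraceful : ℕ → Graph → Set
IsSuperGraceful k G = SuperGracefulLabeling k G

module Submission where

-- Shift every label down by k, so that a k-super graceful
-- labeling of nK₂ becomes a bijection from its 3n elements onto
-- {0, …, 3n-1}.  For the i-th edge with end labels aᵢ, bᵢ and edge label cᵢ
-- the edge condition reads k + cᵢ = |aᵢ - bᵢ|, hence
--   aᵢ + bᵢ + cᵢ = 2 (min(aᵢ, bᵢ) + cᵢ) + k.
-- Call the smaller end and the edge of every K₂ "selected" and let R be the
-- sum of the labels of the 2n selected elements.  Summing over all edges,
--   (1)  3n(3n-1)/2 = 0 + 1 + … + (3n-1) = 2R + nk,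
-- and since the selected elements carry 2n distinct labels,
--   (2)  R ≥ 0 + 1 + … + (2n-1) = n(2n-1).
-- (1) alone gives 3n(2k+3n-1)/2 = 2(2nk + R), which is even; (1) and (2)
-- together give n + 1 ≥ 2k.

open import Defs
open import Data.Nat using (ℕ; _+_; _*_; _∸_; _≤_; _/_)
open import Data.Nat.Divisibility using (_∣_)
open import Data.Product using (_×_)

open import Data.Nat using (zero; suc; _≤?_; ∣_-_∣; z≤n; s≤s)
open import Data.Nat.Properties
open import Data.Nat.DivMod using (m*n/n≡m)
open import Data.Nat.Divisibility using (divides)
open import Data.Nat.Tactic.RingSolver using (solve-∀)
open import Relation.Nullary using (yes; no)
open import Data.Fin using (Fin; toℕ; _↑ˡ_; _↑ʳ_; splitAt)
  renaming (zero to fzero; suc to fsuc)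
open import Data.Fin.Properties using (splitAt-↑ˡ; splitAt-↑ʳ; +↔⊎)
open import Data.Sum using (inj₁; inj₂)
open import Data.Product using (_,_)
open import Function.Bundles using (Inverse; _↔_)
open import Function.Properties.Inverse using (↔-sym; ↔-trans)
open import Function.Properties.Bijection using (⤖⇒↔)
open import Algebra.Properties.Semiring.Sum +-*-semiring
  using (sum; sum-cong-≗; sum-permute; ∑-distrib-+; *-distribˡ-sum)
open import Relation.Binary.PropositionalEquality

sum-const : ∀ n x → sum {n} (λ _ → x) ≡ n * x
sum-const zero    x = refl
sum-const (suc n) x = cong (x +_) (sum-const n x)

sum-split : ∀ a b (f : Fin (a + b) → ℕ) →
  sum f ≡ sum (λ i → f (i ↑ˡ b)) + sum (λ j → f (a ↑ʳ j))
sum-split zero    b f = refl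
sum-split (suc a) b f =
  trans (cong (f fzero +_) (sum-split a b (λ i → f (fsuc i))))
        (sym (+-assoc (f fzero) _ _))

-- A sum indexed by a finite type A does not depend on the enumeration of A:
-- two bijections A ↔ Fin N differ by a permutation of Fin N.
sum-enumeration : ∀ {A : Set} {N} (σ τ : A ↔ Fin N) (Φ : A → ℕ) →
  sum (λ y → Φ (Inverse.from σ y)) ≡ sum (λ y → Φ (Inverse.from τ y))
sum-enumeration σ τ Φ =
  trans (sum-permute (λ y → Φ (Inverse.from σ y)) (↔-trans (↔-sym τ) σ))
        (sum-cong-≗ (λ y → cong Φ (Inverse.strictlyInverseʳ σ (Inverse.from τ y))))

gauss : ∀ N → 2 * sum {N} toℕ + N ≡ N * N
gauss zero    = refl
gauss (suc N) = begin
  2 * sum {N} (λ i → 1 + toℕ i) + suc N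
    ≡⟨ cong (λ s → 2 * s + suc N) (∑-distrib-+ {N} (λ _ → 1) toℕ) ⟩
  2 * (sum {N} (λ _ → 1) + sum {N} toℕ) + suc N
    ≡⟨ cong (λ s → 2 * (s + sum {N} toℕ) + suc N) (trans (sum-const N 1) (*-identityʳ N)) ⟩
  2 * (N + sum {N} toℕ) + suc N
    ≡⟨ regroup N (sum {N} toℕ) ⟩
  (2 * sum {N} toℕ + N) + (2 * N + 1)
    ≡⟨ cong (_+ (2 * N + 1)) (gauss N) ⟩
  N * N + (2 * N + 1)
    ≡⟨ square N ⟩
  suc N * suc N ∎
  where
  open ≡-Reasoning
  regroup : ∀ N s → 2 * (N + s) + suc N ≡ (2 * s + N) + (2 * N + 1)
  regroup = solve-∀
  square : ∀ N → N * N + (2 * N + 1) ≡ suc N * suc N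
  square = solve-∀

-- Sums of distinct numbers: if a 0/1-valued s selects m of the numbers
-- 0, …, N-1, their sum S satisfies S ≥ 0 + 1 + … + (m-1), i.e. m² ≤ 2S + m.
selected-sum-bound : ∀ N (s : Fin N → ℕ) → (∀ v → s v ≤ 1) →
  sum s * sum s ≤ 2 * sum (λ v → s v * toℕ v) + sum s
selected-sum-bound zero    s _ = z≤n
selected-sum-bound (suc N) s s≤1 =
  subst (λ S → sum s * sum s ≤ 2 * (s fzero * 0 + S) + sum s)
        (sym index-shift)
        (step (s fzero) (s≤1 fzero) (selected-sum-bound N s′ (λ v → s≤1 (fsuc v))))
  where
  s′ : Fin N → ℕ
  s′ v = s (fsuc v)
  index-shift : sum (λ v → s′ v * suc (toℕ v)) ≡ sum s′ + sum (λ v → s′ v * toℕ v)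
  index-shift = trans (sum-cong-≗ (λ v → *-suc (s′ v) (toℕ v))) (∑-distrib-+ s′ _)
  -- The bound survives selecting (x = 1) or skipping (x = 0) the index 0.
  step : ∀ {m S} x → x ≤ 1 → m * m ≤ 2 * S + m →
    (x + m) * (x + m) ≤ 2 * (x * 0 + (m + S)) + (x + m)
  step {m} {S} zero _ h = ≤-trans h (+-monoˡ-≤ m (*-monoʳ-≤ 2 (m≤n+m S m)))
  step {m} {S} (suc zero) _ h = begin
    suc m * suc m           ≡⟨ expand m ⟩
    m * m + (2 * m + 1)     ≤⟨ +-monoˡ-≤ (2 * m + 1) h ⟩
    2 * S + m + (2 * m + 1) ≡⟨ collect m S ⟩
    2 * (1 * 0 + (m + S)) + (1 + m) ∎
    where
    open ≤-Reasoning
    expand : ∀ m → suc m * suc m ≡ m * m + (2 * m + 1)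
    expand = solve-∀
    collect : ∀ m S → 2 * S + m + (2 * m + 1) ≡ 2 * (1 * 0 + (m + S)) + (1 + m)
    collect = solve-∀
  step (suc (suc _)) (s≤s ()) _

selectˡ selectʳ : ℕ → ℕ → ℕ
selectˡ x y with x ≤? y
... | yes _ = 1
... | no  _ = 0
selectʳ x y with x ≤? y
... | yes _ = 0
... | no  _ = 1

selectˡ≤1 : ∀ x y → selectˡ x y ≤ 1
selectˡ≤1 x y with x ≤? y
... | yes _ = s≤s z≤n
... | no  _ = z≤n

selectʳ≤1 : ∀ x y → selectʳ x y ≤ 1
selectʳ≤1 x y with x ≤? y
... | yes _ = z≤n
... | no  _ = s≤s z≤n

selected-per-edge : ∀ x y → selectˡ x y + selectʳ x y + 1 ≡ 2
selected-per-edge x y with x ≤? y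
... | yes _ = refl
... | no  _ = refl

-- The per-edge identity: if k + z = |x - y| then
-- x + y + z = 2 (min(x, y) + z) + k, the minimum written with the weights.
edge-identity : ∀ x y z k → k + z ≡ ∣ x - y ∣ →
  x + y + z ≡ 2 * (selectˡ x y * x + selectʳ x y * y + 1 * z) + k
edge-identity x y z k edge with x ≤? y
... | yes x≤y = larger-end x z (trans (cong (x +_) (trans edge (m≤n⇒∣m-n∣≡n∸m x≤y))) (m+[n∸m]≡n x≤y))
  where
  larger-end : ∀ x z → x + (k + z) ≡ y → x + y + z ≡ 2 * (1 * x + 0 * y + 1 * z) + k
  larger-end x z refl = ring x z k
    where
    ring : ∀ x z k → x + (x + (k + z)) + z ≡ 2 * (1 * x + 0 * (x + (k + z)) + 1 * z) + k
    ring = solve-∀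
... | no x≰y = larger-end y z (trans (cong (y +_) (trans edge (m≤n⇒∣n-m∣≡n∸m y≤x))) (m+[n∸m]≡n y≤x))
  where
  y≤x = ≰⇒≥ x≰y
  larger-end : ∀ y z → y + (k + z) ≡ x → x + y + z ≡ 2 * (0 * x + 1 * y + 1 * z) + k
  larger-end y z refl = ring y z k
    where
    ring : ∀ y z k → y + (k + z) + y + z ≡ 2 * (0 * (y + (k + z)) + 1 * y + 1 * z) + k
    ring = solve-∀

-- From (1): 3n(2k + 3n - 1) = 4(2nk + R), so its half is even.
half-even : ∀ n k R → 2 * (2 * R + n * k) + 3 * n ≡ 3 * n * (3 * n) →
  2 ∣ ((3 * n * (2 * k + 3 * n ∸ 1)) / 2)
half-even n k R total =
  subst (2 ∣_) (sym (trans (cong (_/ 2) product) (m*n/n≡m (2 * Q) 2)))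
        (divides Q (*-comm 2 Q))
  where
  open ≡-Reasoning
  Q = 2 * n * k + R
  product : 3 * n * (2 * k + 3 * n ∸ 1) ≡ 2 * Q * 2
  product = begin
    3 * n * (2 * k + 3 * n ∸ 1)                 ≡⟨ *-distribˡ-∸ (3 * n) (2 * k + 3 * n) 1 ⟩
    3 * n * (2 * k + 3 * n) ∸ 3 * n * 1         ≡⟨ cong₂ _∸_ (*-distribˡ-+ (3 * n) (2 * k) (3 * n)) (*-identityʳ (3 * n)) ⟩
    3 * n * (2 * k) + 3 * n * (3 * n) ∸ 3 * n   ≡⟨ cong (λ t → 3 * n * (2 * k) + t ∸ 3 * n) (sym total) ⟩
    3 * n * (2 * k) + (2 * (2 * R + n * k) + 3 * n) ∸ 3 * n ≡⟨ cong (_∸ 3 * n) (regroup n k R) ⟩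
    2 * Q * 2 + 3 * n ∸ 3 * n                   ≡⟨ m+n∸n≡m (2 * Q * 2) (3 * n) ⟩
    2 * Q * 2 ∎
    where
    regroup : ∀ n k R → 3 * n * (2 * k) + (2 * (2 * R + n * k) + 3 * n) ≡ 2 * (2 * n * k + R) * 2 + 3 * n
    regroup = solve-∀

-- From (1) and (2): n(2k + 8n + 3) ≤ n(n + 1 + 8n + 3), so 2k ≤ n + 1.
k-bound : ∀ n k R → 1 ≤ n → (n * 2) * (n * 2) ≤ 2 * R + n * 2 →
  2 * (2 * R + n * k) + 3 * n ≡ 3 * n * (3 * n) → 2 * k ∸ 1 ≤ n
k-bound n@(suc _) k R _ selected total =
  ≤-trans (∸-monoˡ-≤ 1 2k≤n+1) (≤-reflexive (m+n∸n≡m n 1))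
  where
  open ≤-Reasoning
  scaled : n * (2 * k + (8 * n + 3)) + 4 * R ≤ n * (n + 1 + (8 * n + 3)) + 4 * R
  scaled = begin
    n * (2 * k + (8 * n + 3)) + 4 * R                         ≡⟨ lhs n k R ⟩
    2 * ((n * 2) * (n * 2)) + (2 * (2 * R + n * k) + 3 * n)   ≤⟨ +-monoˡ-≤ _ (*-monoʳ-≤ 2 selected) ⟩
    2 * (2 * R + n * 2) + (2 * (2 * R + n * k) + 3 * n)       ≡⟨ cong (2 * (2 * R + n * 2) +_) total ⟩
    2 * (2 * R + n * 2) + 3 * n * (3 * n)                     ≡⟨ rhs n R ⟩
    n * (n + 1 + (8 * n + 3)) + 4 * R ∎
    where
    lhs : ∀ n k R → n * (2 * k + (8 * n + 3)) + 4 * R ≡ 2 * ((n * 2) * (n * 2)) + (2 * (2 * R + n * k) + 3 * n)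
    lhs = solve-∀
    rhs : ∀ n R → 2 * (2 * R + n * 2) + 3 * n * (3 * n) ≡ n * (n + 1 + (8 * n + 3)) + 4 * R
    rhs = solve-∀
  2k≤n+1 : 2 * k ≤ n + 1
  2k≤n+1 = +-cancelʳ-≤ (8 * n + 3) _ _ (*-cancelˡ-≤ n (+-cancelʳ-≤ (4 * R) _ _ scaled))

module Labeling (n k : ℕ) (L : SuperGracefulLabeling k (nK₂ n)) where

  shifted : Elem (nK₂ n) ↔ Fin (n + n + n)
  shifted = ⤖⇒↔ (SuperGracefulLabeling.bij L)

  label : Elem (nK₂ n) → ℕ
  label e = toℕ (Inverse.to shifted e)

  a b c : Fin n → ℕ
  a i = label (inj₁ (i ↑ˡ n))
  b i = label (inj₁ (n ↑ʳ i))
  c i = label (inj₂ i)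

  edge-condition : ∀ i → k + c i ≡ ∣ a i - b i ∣
  edge-condition i =
    trans (SuperGracefulLabeling.edge-cond L i) (∣m+n-m+o∣≡∣n-o∣ k (a i) (b i))

  -- Every element of nK₂ is an end or an edge of exactly one K₂, so a sum over
  -- all labels is a sum over the edges.  Φ may depend on the element and its label.
  sum-by-edges : (Φ : Elem (nK₂ n) → ℕ → ℕ) →
    sum (λ y → Φ (Inverse.from shifted y) (toℕ y)) ≡
    sum (λ i → Φ (inj₁ (i ↑ˡ n)) (a i) + Φ (inj₁ (n ↑ʳ i)) (b i) + Φ (inj₂ i) (c i))
  sum-by-edges Φ = begin
    sum (λ y → Φ (Inverse.from shifted y) (toℕ y))
      ≡⟨ sum-cong-≗ (λ y → cong (λ j → Φ _ (toℕ j)) (sym (Inverse.strictlyInverseˡ shifted y))) ⟩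
    sum (λ y → Ψ (Inverse.from shifted y))
      ≡⟨ sum-enumeration shifted (↔-sym (+↔⊎ {n + n} {n})) Ψ ⟩
    sum (λ x → Ψ (splitAt (n + n) x))
      ≡⟨ sum-split (n + n) n _ ⟩
    sum (λ x → Ψ (splitAt (n + n) (x ↑ˡ n))) + sum (λ i → Ψ (splitAt (n + n) ((n + n) ↑ʳ i)))
      ≡⟨ cong₂ _+_ (trans (sum-cong-≗ (λ x → cong Ψ (splitAt-↑ˡ (n + n) x n))) (sum-split n n _))
                   (sum-cong-≗ (λ i → cong Ψ (splitAt-↑ʳ (n + n) n i))) ⟩
    sum (λ i → Ψ (inj₁ (i ↑ˡ n))) + sum (λ i → Ψ (inj₁ (n ↑ʳ i))) + sum (λ i → Ψ (inj₂ i))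
      ≡⟨ cong (_+ sum (λ i → Ψ (inj₂ i))) (sym (∑-distrib-+ {n} _ _)) ⟩
    sum (λ i → Ψ (inj₁ (i ↑ˡ n)) + Ψ (inj₁ (n ↑ʳ i))) + sum (λ i → Ψ (inj₂ i))
      ≡⟨ sym (∑-distrib-+ {n} _ _) ⟩
    sum (λ i → Ψ (inj₁ (i ↑ˡ n)) + Ψ (inj₁ (n ↑ʳ i)) + Ψ (inj₂ i)) ∎
    where
    open ≡-Reasoning
    Ψ : Elem (nK₂ n) → ℕ
    Ψ e = Φ e (label e)

  selected : Elem (nK₂ n) → ℕ
  selected (inj₁ x) with splitAt n x
  ... | inj₁ i = selectˡ (a i) (b i)
  ... | inj₂ i = selectʳ (a i) (b i)
  selected (inj₂ _) = 1

  selected≤1 : ∀ e → selected e ≤ 1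
  selected≤1 (inj₁ x) with splitAt n x
  ... | inj₁ i = selectˡ≤1 (a i) (b i)
  ... | inj₂ i = selectʳ≤1 (a i) (b i)
  selected≤1 (inj₂ _) = ≤-refl

  selected-label : Fin (n + n + n) → ℕ
  selected-label y = selected (Inverse.from shifted y)

  Rᵢ : Fin n → ℕ
  Rᵢ i = selectˡ (a i) (b i) * a i + selectʳ (a i) (b i) * b i + 1 * c i

  R : ℕ
  R = sum Rᵢ

  label-total : sum {n + n + n} toℕ ≡ 2 * R + n * k
  label-total = begin
    sum {n + n + n} toℕ                ≡⟨ sum-by-edges (λ _ t → t) ⟩
    sum (λ i → a i + b i + c i)        ≡⟨ sum-cong-≗ (λ i → edge-identity (a i) (b i) (c i) k (edge-condition i)) ⟩
    sum (λ i → 2 * Rᵢ i + k)           ≡⟨ ∑-distrib-+ {n} _ _ ⟩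
    sum (λ i → 2 * Rᵢ i) + sum {n} (λ _ → k) ≡⟨ cong₂ _+_ (sym (*-distribˡ-sum 2 Rᵢ)) (sum-const n k) ⟩
    2 * R + n * k ∎
    where open ≡-Reasoning

  selected-count : sum selected-label ≡ n * 2
  selected-count = begin
    sum selected-label                 ≡⟨ sum-by-edges (λ e _ → selected e) ⟩
    sum (λ i → selected (inj₁ (i ↑ˡ n)) + selected (inj₁ (n ↑ʳ i)) + 1) ≡⟨ sum-cong-≗ per-edge ⟩
    sum {n} (λ _ → 2)                  ≡⟨ sum-const n 2 ⟩
    n * 2 ∎
    where
    open ≡-Reasoning
    per-edge : ∀ i → selected (inj₁ (i ↑ˡ n)) + selected (inj₁ (n ↑ʳ i)) + 1 ≡ 2
    per-edge i rewrite splitAt-↑ˡ n i n | splitAt-↑ʳ n n i = selected-per-edge (a i) (b i)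

  selected-total : sum (λ y → selected-label y * toℕ y) ≡ R
  selected-total = trans (sum-by-edges (λ e t → selected e * t)) (sum-cong-≗ per-edge)
    where
    per-edge : ∀ i → selected (inj₁ (i ↑ˡ n)) * a i + selected (inj₁ (n ↑ʳ i)) * b i + 1 * c i
                   ≡ Rᵢ i
    per-edge i rewrite splitAt-↑ˡ n i n | splitAt-↑ʳ n n i = refl

  total : 2 * (2 * R + n * k) + 3 * n ≡ 3 * n * (3 * n)
  total = subst (λ N → 2 * (2 * R + n * k) + N ≡ N * N) (sym (three-times n))
                (subst (λ T → 2 * T + (n + n + n) ≡ (n + n + n) * (n + n + n)) label-total (gauss (n + n + n)))
    where
    three-times : ∀ n → 3 * n ≡ n + n + n
    three-times = solve-∀

  selected-bound : (n * 2) * (n * 2) ≤ 2 * R + n * 2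
  selected-bound = subst₂ (λ m S → m * m ≤ 2 * S + m) selected-count selected-total
    (selected-sum-bound (n + n + n) selected-label (λ y → selected≤1 (Inverse.from shifted y)))

lemma3p12 : (n k : ℕ) → 1 ≤ n → 1 ≤ k → IsSuperGraceful k (nK₂ n) →
    (2 ∣ ((3 * n * (2 * k + 3 * n ∸ 1)) / 2)) × (2 * k ∸ 1 ≤ n)
lemma3p12 n k 1≤n _ L =
  half-even n k R total , k-bound n k R 1≤n selected-bound total
  where open Labeling n k L
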